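{- Let $G$ be a finite, simple, connected graph on $N$ nodes. If the complete graph $K_4$ is a subgraph of $G$, then $\chi^o(G)=1$. In particular, if $N\geq4$, then $\chi^o(K_N)=1$, where $K_N$ is the complete graph on $N$ nodes.
   Context: All graphs are finite, simple and connected. An oriented edge $[v,w]$ is an edge $\{v,w\}$ with input $v$ and output $w$; $\mathcal{O}=\{[v,w],[w,v]: v\sim w\}$. For $k\geq 1$, $G$ is circularly $k$-partite if $\mathcal{O}$ can be partitioned as $\mathcal{O}=\mathcal{O}_1\sqcup\cdots\sqcup\mathcal{O}_k$ with all $\mathcal{O}_j$ non-empty and such that $[v,w]\in\mathcal{O}_j$ implies $[w,z]\in\mathcal{O}_{j+1}$ for every $z\sim w$ with $z\neq v$, indices modulo $k$. The oriented edge periodic colouring number $\chi^o(G)$ is the largest $k$ such that $G$ is circularly $k$-partite. -}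

module Defs where

open import Data.Nat using (ℕ; zero; suc; _≤_; _%_)
open import Data.Fin using (Fin; toℕ)
open import Data.Fin.Properties using (_≟_)
open import Data.Bool using (Bool; true; false)
open import Data.Product using (Σ; ∃; _×_; _,_)
open import Relation.Nullary using (¬_; yes; no; does)
open import Relation.Binary.PropositionalEquality using (_≡_; _≢_; refl)
open import Function using (Injective)
open import Data.Empty using (⊥)

data Walk {N : ℕ} (adj : Fin N → Fin N → Bool) : Fin N → Fin N → Set where
  nil  : ∀ {v} → Walk adj v v
  cons : ∀ {u v w} → adj u v ≡ true → Walk adj v w → Walk adj u w

record Graph (N : ℕ) : Set where
  field
    adj       : Fin N → Fin N → Bool
    symmetric : ∀ v w → adj v w ≡ true → adj w v ≡ true
    loopless  : ∀ v → adj v v ≡ false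
    connected : ∀ v w → Walk adj v w

open Graph public

_∼[_]_ : ∀ {N} → Fin N → Graph N → Fin N → Set
v ∼[ G ] w = adj G v w ≡ true

-- G is circularly k-partite, for k = suc m ≥ 1.
-- The oriented edge [v,w] (v ∼ w) is coloured by c v w _ ∈ Fin k, i.e. it lies in O_{c v w};
-- every class is non-empty, and [v,w] ∈ O_j implies [w,z] ∈ O_{j+1 mod k} for z ∼ w, z ≠ v.
-- (k = 0 is excluded by definition: the paper only considers k ≥ 1.)
CircularlyPartite : ∀ {N} → Graph N → ℕ → Set
CircularlyPartite G zero = ⊥
CircularlyPartite {N} G k@(suc _) =
  Σ ((v w : Fin N) → v ∼[ G ] w → Fin k) λ c →
    ((j : Fin k) → Σ (Fin N) λ v → Σ (Fin N) λ w → Σ (v ∼[ G ] w) λ p → c v w p ≡ j)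
    × (∀ v w z (p : v ∼[ G ] w) (q : w ∼[ G ] z) → z ≢ v →
         toℕ (c w z q) ≡ suc (toℕ (c v w p)) % k)

ChiO≡ : ∀ {N} → Graph N → ℕ → Set
ChiO≡ G n = CircularlyPartite G n × (∀ k → 1 ≤ k → CircularlyPartite G k → k ≤ n)

HasK4 : ∀ {N} → Graph N → Set
HasK4 {N} G = Σ (Fin 4 → Fin N) λ f → Injective _≡_ _≡_ f × (∀ i j → i ≢ j → f i ∼[ G ] f j)

completeAdj : ∀ {N} → Fin N → Fin N → Bool
completeAdj v w = Data.Bool.not (does (v ≟ w))

private
  open import Data.Bool using (not)
  open import Relation.Binary.PropositionalEquality using (sym)

  sym-K : ∀ {N} (v w : Fin N) → completeAdj v w ≡ true → completeAdj w v ≡ true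
  sym-K v w e with w ≟ v
  ... | no _ = refl
  ... | yes refl with v ≟ v
  ...   | yes _ = e
  ...   | no ¬p = Data.Empty.⊥-elim (¬p refl)
    where import Data.Empty

  loop-K : ∀ {N} (v : Fin N) → completeAdj v v ≡ false
  loop-K v with v ≟ v
  ... | yes _ = refl
  ... | no ¬p = Data.Empty.⊥-elim (¬p refl)
    where import Data.Empty

  conn-K : ∀ {N} (v w : Fin N) → Walk completeAdj v w
  conn-K v w with v ≟ w in eq
  ... | yes refl = nil
  ... | no _ = cons e nil
    where
    e : completeAdj v w ≡ true
    e rewrite eq = refl

K : (N : ℕ) → Graph N
K N = record { adj = completeAdj ; symmetric = sym-K ; loopless = loop-K ; connected = conn-K }

{-# OPTIONS --safe #-}
-- Colours advance by one along every non-backtracking step. In a K₄ on a, b, c, d the walks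
-- a→b→c→d→a and a→b→d→a both end on the oriented edge [d,a], three and two steps after [a,b];
-- if [a,b] has colour n, then [d,a] has colour both n + 3 and n + 2 modulo k, forcing k = 1. Conversely, any graph
-- with an edge is circularly 1-partite, and Kₙ contains a K₄ as soon as n ≥ 4.
module Submission where

open import Defs
open import Data.Nat using (ℕ; zero; suc; _+_; _≤_; _<_; _%_; NonZero; s≤s; z≤n)
open import Data.Nat.Properties using (≤-refl; <⇒≢; ≤∧≢⇒<; 1+n≢n; _≟_)
open import Data.Nat.DivMod using (%-distribˡ-+; m%n%n≡m%n; m%n<n; m<n⇒m%n≡m; n%n≡0)
open import Data.Fin using (Fin; toℕ; inject≤; #_) renaming (zero to fzero)
open import Data.Fin.Properties using (toℕ<n; inject≤-injective) renaming (_≟_ to _≟ᶠ_)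
open import Data.Product using (_×_; _,_)
open import Function using (_∘_)
open import Data.Empty using (⊥-elim)
open import Relation.Nullary using (yes; no; contradiction)
open import Relation.Binary.PropositionalEquality
open ≡-Reasoning

suc-%-% : ∀ m k .{{_ : NonZero k}} → suc (m % k) % k ≡ suc m % k
suc-%-% m k = begin
  (1 + m % k) % k          ≡⟨ %-distribˡ-+ 1 (m % k) k ⟩
  (1 % k + m % k % k) % k  ≡⟨ cong (λ t → (1 % k + t) % k) (m%n%n≡m%n m k) ⟩
  (1 % k + m % k) % k      ≡⟨ %-distribˡ-+ 1 m k ⟨
  (1 + m) % k              ∎

suc-%-≢ : ∀ {k} .{{_ : NonZero k}} → 1 < k → ∀ m → suc m % k ≢ m % k
suc-%-≢ {k} 1<k m eq with suc (m % k) ≟ k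
... | yes r+1≡k = <⇒≢ 1<k (trans (cong suc (sym r≡0)) r+1≡k)
  where
  r≡0 : m % k ≡ 0
  r≡0 = begin
    m % k              ≡⟨ eq ⟨
    suc m % k          ≡⟨ suc-%-% m k ⟨
    suc (m % k) % k    ≡⟨ cong (_% k) r+1≡k ⟩
    k % k              ≡⟨ n%n≡0 k ⟩
    0                  ∎
... | no r+1≢k = 1+n≢n (begin
    suc (m % k)        ≡⟨ m<n⇒m%n≡m (≤∧≢⇒< (m%n<n m k) r+1≢k) ⟨
    suc (m % k) % k    ≡⟨ suc-%-% m k ⟩
    suc m % k          ≡⟨ eq ⟩
    m % k              ∎)

module ColourAdvance
  {N k} .{{_ : NonZero k}} {G : Graph N} (c : ∀ v w → v ∼[ G ] w → Fin k)
  (advance : ∀ v w z (p : v ∼[ G ] w) (q : w ∼[ G ] z) → z ≢ v →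
               toℕ (c w z q) ≡ suc (toℕ (c v w p)) % k)
  where

  colour-step : ∀ {v w z} {p : v ∼[ G ] w} n (q : w ∼[ G ] z) → z ≢ v →
                toℕ (c v w p) ≡ n % k → toℕ (c w z q) ≡ suc n % k
  colour-step {v} {w} {z} {p} n q z≢v cvw≡n = begin
    toℕ (c w z q)            ≡⟨ advance v w z p q z≢v ⟩
    suc (toℕ (c v w p)) % k  ≡⟨ cong (λ t → suc t % k) cvw≡n ⟩
    suc (n % k) % k          ≡⟨ suc-%-% n k ⟩
    suc n % k                ∎

  colour≡colour%k : ∀ {v w} (p : v ∼[ G ] w) → toℕ (c v w p) ≡ toℕ (c v w p) % k
  colour≡colour%k p = sym (m<n⇒m%n≡m (toℕ<n (c _ _ p)))

HasK4⇒χ≤1 : ∀ {N} {G : Graph N} → HasK4 G → ∀ k → CircularlyPartite G k → k ≤ 1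
HasK4⇒χ≤1 _ zero ()
HasK4⇒χ≤1 _ (suc zero) _ = ≤-refl
HasK4⇒χ≤1 {G = G} (f , f-injective , edge) k@(suc (suc _)) (colouring , _ , advance) =
  ⊥-elim (suc-%-≢ {k} (s≤s (s≤s z≤n)) (2 + n) (trans (sym da-via-c) da-via-d))
  where
  open ColourAdvance {G = G} colouring advance

  a b c d : Fin 4
  a = # 0
  b = # 1
  c = # 2
  d = # 3

  distinct : ∀ {i j} → i ≢ j → f i ≢ f j
  distinct i≢j = i≢j ∘ f-injective

  colour : ∀ {i j} → f i ∼[ G ] f j → ℕ
  colour p = toℕ (colouring _ _ p)

  ab : f a ∼[ G ] f b
  ab = edge a b (λ ())
  bc : f b ∼[ G ] f c
  bc = edge b c (λ ())
  bd : f b ∼[ G ] f d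
  bd = edge b d (λ ())
  cd : f c ∼[ G ] f d
  cd = edge c d (λ ())
  da : f d ∼[ G ] f a
  da = edge d a (λ ())

  n : ℕ
  n = colour ab

  bc-via-a : colour bc ≡ suc n % k
  bc-via-a = colour-step n bc (distinct (λ ())) (colour≡colour%k ab)
  cd-via-b : colour cd ≡ (2 + n) % k
  cd-via-b = colour-step (1 + n) cd (distinct (λ ())) bc-via-a
  da-via-c : colour da ≡ (3 + n) % k
  da-via-c = colour-step (2 + n) da (distinct (λ ())) cd-via-b
  bd-via-a : colour bd ≡ suc n % k
  bd-via-a = colour-step n bd (distinct (λ ())) (colour≡colour%k ab)
  da-via-d : colour da ≡ (2 + n) % k
  da-via-d = colour-step (1 + n) da (distinct (λ ())) bd-via-a

edge⇒CircularlyPartite1 : ∀ {N} {G : Graph N} {v w} → v ∼[ G ] w → CircularlyPartite G 1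
edge⇒CircularlyPartite1 {v = v} {w} p =
  (λ _ _ _ → fzero) , (λ { fzero → v , w , p , refl }) , (λ _ _ _ _ _ _ → refl)

HasK4⇒χ≡1 : ∀ {N} {G : Graph N} → HasK4 G → ChiO≡ G 1
HasK4⇒χ≡1 {G = G} K4@(_ , _ , edge) =
  edge⇒CircularlyPartite1 {G = G} (edge (# 0) (# 1) (λ ())) , λ k _ → HasK4⇒χ≤1 K4 k

K-adjacent : ∀ {N} {v w : Fin N} → v ≢ w → v ∼[ K N ] w
K-adjacent {v = v} {w} v≢w with v ≟ᶠ w
... | yes v≡w = contradiction v≡w v≢w
... | no _    = refl

K-HasK4 : ∀ {N} → 4 ≤ N → HasK4 (K N)
K-HasK4 4≤N =
  (λ i → inject≤ i 4≤N) ,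
  inject≤-injective 4≤N 4≤N _ _ ,
  λ i j i≢j → K-adjacent (i≢j ∘ inject≤-injective 4≤N 4≤N i j)

corollary3p3 : (∀ (N : ℕ) (G : Graph N) → HasK4 G → ChiO≡ G 1)
    × (∀ (N : ℕ) → 4 ≤ N → ChiO≡ (K N) 1)
corollary3p3 = (λ _ _ → HasK4⇒χ≡1) , (λ _ → HasK4⇒χ≡1 ∘ K-HasK4)
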